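{- For $n\ge1$ let $f_{n,i}$ be the coefficient of $x^i$ in $(1+x+x^2)^n$. Then for all sufficiently large $n$ of the form $n=3s$ with $s$ a positive integer, and all integers $k$ with $0<k<s$, \[ f_{n,2k-1}+2f_{n,2k}+\sum_{i=2k+1}^{\lfloor (n+k)/2\rfloor} f_{n,i}-f_{n,n-k}<0, \] where the sum is empty if $2k+1>\lfloor (n+k)/2\rfloor$.
   Context: $\lfloor x\rfloor$ denotes the integer part of $x$. -}

module Defs where

open import Data.Nat using (ℕ; zero; suc; _+_; _*_)
open import Data.List using (List; []; _∷_; map)
open import Data.Integer as ℤ using (ℤ)

-- Polynomials with ℕ coefficients, as coefficient lists (constant term first).
Poly : Set
Poly = List ℕ

addP : Poly → Poly → Poly
addP [] q = q
addP p [] = p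
addP (a ∷ p) (b ∷ q) = (a + b) ∷ addP p q

mulP : Poly → Poly → Poly
mulP [] q = []
mulP (a ∷ p) q = addP (map (a *_) q) (0 ∷ mulP p q)

powP : Poly → ℕ → Poly
powP p zero = 1 ∷ []
powP p (suc n) = mulP (powP p n) p

coeff : ℕ → Poly → ℕ
coeff i [] = 0
coeff zero (a ∷ p) = a
coeff (suc i) (a ∷ p) = coeff i p

tri : Poly
tri = 1 ∷ 1 ∷ 1 ∷ []

f : ℕ → ℕ → ℕ
f n i = coeff i (powP tri n)

sumFrom : ℕ → ℕ → (ℕ → ℤ) → ℤ
sumFrom a zero g = ℤ.+ 0
sumFrom a (suc len) g = g a ℤ.+ sumFrom (suc a) len g

-- Write aᵢ = f n i. Comparing coefficients in (1+x+x²)P′ = n(1+2x)P for P = (1+x+x²)ⁿ gives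
-- (i+1)aᵢ₊₁ = (n−i)aᵢ + (2n−i+1)aᵢ₋₁. The sequence (aᵢ) is log-concave, since it arises from a
-- single point by repeated convolution with (1,1,1), and such convolution preserves
-- log-concavity of sequences without internal zeros. Feeding aᵢ₋₁aᵢ₊₁ ≤ aᵢ² into the recurrence
-- bounds aᵢ₊₁/aᵢ from below: it is at least 1 for i < n, and at least 5/3 whenever
-- 49i + 65 ≤ 33n, which for n = 3s and s ≥ 114 covers all i ≤ 2s + 1. Hence the left-hand sum,
-- which ends at M = ⌊(n+k)/2⌋ ≤ 2s − 1, is at most (5/2)a_M + a_M, whereas
-- a_{n−k} ≥ a_{M+3} ≥ (5/3)³a_M because n − k ≥ M + 3. The one exception is k = s − 1, where
-- n − k = M + 2 but the sum a_{2k−1} + 2a_{2k} + a_{2k+1} is short enough.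

module Submission where

open import Defs
open import Data.Nat
open import Data.Nat.Properties
open import Data.Nat.DivMod using (m/n*n≤m; m≡m%n+[m/n]*n; m%n<n; +-distrib-/-∣ʳ; m*n/n≡m)
open import Data.Nat.Divisibility using (divides)
open import Data.Nat.Tactic.RingSolver using (solve; solve-∀)
open import Data.Integer as ℤ using (+_)
import Data.Integer.Properties as ℤP
open import Data.List using ([]; _∷_; map)
open import Data.Product using (∃; _,_; _×_; proj₁; proj₂)
open import Data.Sum using (inj₁; inj₂)
open import Relation.Nullary using (yes; no; contradiction)
open import Relation.Binary.PropositionalEquality
open import Algebra.Properties.CommutativeSemigroup *-commutativeSemigroup using (x∙yz≈y∙xz)

-- The coefficients of (1 + x + x²)ⁿ

coeff-addP : ∀ i p q → coeff i (addP p q) ≡ coeff i p + coeff i q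
coeff-addP i [] q = refl
coeff-addP i (a ∷ p) [] = sym (+-identityʳ _)
coeff-addP zero (a ∷ p) (b ∷ q) = refl
coeff-addP (suc i) (a ∷ p) (b ∷ q) = coeff-addP i p q

-- coeff₂ i p is the coefficient of xⁱ in x²·p, so F n i = f n (i ∸ 2) for i ≥ 2 and
-- F n 0 = F n 1 = 0; with this shift the trinomial recurrence F-suc has no boundary cases.
coeff₂ : ℕ → Poly → ℕ
coeff₂ i p = coeff i (0 ∷ 0 ∷ p)

coeff₂-mulP-tri : ∀ p i → coeff₂ (2 + i) (mulP p tri) ≡ coeff₂ i p + coeff₂ (1 + i) p + coeff₂ (2 + i) p
coeff₂-mulP-tri [] zero = refl
coeff₂-mulP-tri [] (suc zero) = refl
coeff₂-mulP-tri [] (suc (suc i)) = refl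
coeff₂-mulP-tri (a ∷ p) i = trans (coeff-addP i (map (a *_) tri) (0 ∷ mulP p tri)) (window i)
  where
  window : ∀ i → coeff i (map (a *_) tri) + coeff i (0 ∷ mulP p tri)
               ≡ coeff₂ i (a ∷ p) + coeff₂ (1 + i) (a ∷ p) + coeff₂ (2 + i) (a ∷ p)
  window zero = trans (+-identityʳ (a * 1)) (*-identityʳ a)
  window (suc zero) = cong₂ _+_ (*-identityʳ a) (coeff₂-mulP-tri p 0)
  window (suc (suc zero)) =
    trans (cong₂ _+_ (*-identityʳ a) (coeff₂-mulP-tri p 1)) (sym (+-assoc a (coeff 0 p) (coeff 1 p)))
  window (suc (suc (suc i))) = coeff₂-mulP-tri p (2 + i)

F : ℕ → ℕ → ℕ
F n i = coeff₂ i (powP tri n)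

F-suc : ∀ n i → F (suc n) (2 + i) ≡ F n i + F n (1 + i) + F n (2 + i)
F-suc n = coeff₂-mulP-tri (powP tri n)

-- The coefficient of xʲ in (1+x+x²)P′ = n(1+2x)P, where x, y, z are the coefficients of
-- x^(j−1), xʲ, x^(j+1) in P; x is added to both sides to keep the identity subtraction-free.
DiffRec : ℕ → ℕ → ℕ → ℕ → ℕ → Set
DiffRec n j x y z = suc j * z + j * y + j * x ≡ n * y + 2 * n * x + x

cancel-by : ∀ {x y u v} → x + u ≡ y + v → u ≡ v → x ≡ y
cancel-by {x} {y} {u} e refl = +-cancelʳ-≡ u x y e

DiffRec-step : ∀ {n j a₁ a₂ a₃ a₄ a₅ b₃ b₄ b₅} →
  b₃ ≡ a₁ + a₂ + a₃ → b₄ ≡ a₂ + a₃ + a₄ → b₅ ≡ a₃ + a₄ + a₅ →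
  DiffRec n j a₁ a₂ a₃ → DiffRec n (1 + j) a₂ a₃ a₄ → DiffRec n (2 + j) a₃ a₄ a₅ →
  DiffRec (suc n) (2 + j) b₃ b₄ b₅
DiffRec-step {n} {j} {a₁} {a₂} {a₃} {a₄} {a₅} refl refl refl e₁ e₂ e₃ =
  cancel-by (shuffle n j a₁ a₂ a₃ a₄ a₅) (sym (cong₂ _+_ (cong₂ _+_ e₁ e₂) e₃))
  where
  shuffle : ∀ n j a₁ a₂ a₃ a₄ a₅ →
    (3 + j) * (a₃ + a₄ + a₅) + (2 + j) * (a₂ + a₃ + a₄) + (2 + j) * (a₁ + a₂ + a₃)
      + ((n * a₂ + 2 * n * a₁ + a₁) + (n * a₃ + 2 * n * a₂ + a₂) + (n * a₄ + 2 * n * a₃ + a₃))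
    ≡ suc n * (a₂ + a₃ + a₄) + 2 * suc n * (a₁ + a₂ + a₃) + (a₁ + a₂ + a₃)
      + ((suc j * a₃ + j * a₂ + j * a₁) + ((2 + j) * a₄ + suc j * a₃ + suc j * a₂)
         + ((3 + j) * a₅ + (2 + j) * a₄ + (2 + j) * a₃))
  shuffle = solve-∀

-- DiffRec-step for j = −2 and j = −1, where the out-of-range coefficients vanish.
DiffRec-base₀ : ∀ {n a₂ a₃ b₂ b₃} → b₂ ≡ a₂ → b₃ ≡ a₂ + a₃ →
  DiffRec n 0 0 a₂ a₃ → DiffRec (suc n) 0 0 b₂ b₃
DiffRec-base₀ {n} {a₂} {a₃} refl refl e = cancel-by (shuffle n a₂ a₃) (sym e)
  where
  shuffle : ∀ n a₂ a₃ → 1 * (a₂ + a₃) + 0 * a₂ + 0 * 0 + (n * a₂ + 2 * n * 0 + 0)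
                      ≡ suc n * a₂ + 2 * suc n * 0 + 0 + (1 * a₃ + 0 * a₂ + 0 * 0)
  shuffle = solve-∀

DiffRec-base₁ : ∀ {n a₂ a₃ a₄ b₂ b₃ b₄} → b₂ ≡ a₂ → b₃ ≡ a₂ + a₃ → b₄ ≡ a₂ + a₃ + a₄ →
  DiffRec n 0 0 a₂ a₃ → DiffRec n 1 a₂ a₃ a₄ → DiffRec (suc n) 1 b₂ b₃ b₄
DiffRec-base₁ {n} {a₂} {a₃} {a₄} refl refl refl e₁ e₂ =
  cancel-by (shuffle n a₂ a₃ a₄) (sym (cong₂ _+_ e₁ e₂))
  where
  shuffle : ∀ n a₂ a₃ a₄ →
    2 * (a₂ + a₃ + a₄) + 1 * (a₂ + a₃) + 1 * a₂
      + ((n * a₂ + 2 * n * 0 + 0) + (n * a₃ + 2 * n * a₂ + a₂))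
    ≡ suc n * (a₂ + a₃) + 2 * suc n * a₂ + a₂
      + ((1 * a₃ + 0 * a₂ + 0 * 0) + (2 * a₄ + 1 * a₃ + 1 * a₂))
  shuffle = solve-∀

DiffRec-F : ∀ n j → DiffRec n j (F n (1 + j)) (F n (2 + j)) (F n (3 + j))
DiffRec-F zero zero = refl
DiffRec-F zero (suc zero) = refl
DiffRec-F zero (suc (suc j)) = solve (j ∷ [])
DiffRec-F (suc n) zero = DiffRec-base₀ {n} (F-suc n 0) (F-suc n 1) (DiffRec-F n 0)
DiffRec-F (suc n) (suc zero) =
  DiffRec-base₁ {n} (F-suc n 0) (F-suc n 1) (F-suc n 2) (DiffRec-F n 0) (DiffRec-F n 1)
DiffRec-F (suc n) (suc (suc j)) =
  DiffRec-step {n} {j} (F-suc n (1 + j)) (F-suc n (2 + j)) (F-suc n (3 + j))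
    (DiffRec-F n j) (DiffRec-F n (1 + j)) (DiffRec-F n (2 + j))

F-vanishes : ∀ n i → 2 * n + 3 ≤ i → F n i ≡ 0
F-vanishes n zero _ = refl
F-vanishes n (suc zero) _ = refl
F-vanishes zero (suc (suc zero)) (s≤s (s≤s ()))
F-vanishes zero (suc (suc (suc i))) _ = refl
F-vanishes (suc n) (suc (suc m)) le = begin
  F (suc n) (2 + m)                     ≡⟨ F-suc n m ⟩
  F n m + F n (1 + m) + F n (2 + m)     ≡⟨ cong₂ _+_ (cong₂ _+_ (F-vanishes n m m≥)
                                             (F-vanishes n (1 + m) (m≤n⇒m≤1+n m≥)))
                                             (F-vanishes n (2 + m) (m≤n⇒m≤1+n (m≤n⇒m≤1+n m≥))) ⟩
  0                                     ∎
  where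
  open ≡-Reasoning
  m≥ : 2 * n + 3 ≤ m
  m≥ = s≤s⁻¹ (s≤s⁻¹ (subst (_≤ 2 + m) (cong (_+ 3) (*-suc 2 n)) le))

F-pos : ∀ n i → 2 ≤ i → i ≤ 2 * n + 2 → 0 < F n i
F-pos n (suc zero) (s≤s ()) _
F-pos zero (suc (suc zero)) _ _ = s≤s z≤n
F-pos zero (suc (suc (suc i))) _ (s≤s (s≤s ()))
F-pos (suc n) (suc (suc m)) _ le = subst (0 <_) (sym (F-suc n m)) (some-summand m m≤)
  where
  m≤ : m ≤ 2 * n + 2
  m≤ = s≤s⁻¹ (s≤s⁻¹ (subst (2 + m ≤_) (cong (_+ 2) (*-suc 2 n)) le))
  2n+2≡ : 2 * n + 2 ≡ suc (2 * n + 1)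
  2n+2≡ = +-suc (2 * n) 1
  some-summand : ∀ m → m ≤ 2 * n + 2 → 0 < F n m + F n (1 + m) + F n (2 + m)
  some-summand zero _ = <-≤-trans (F-pos n 2 ≤-refl (m≤n+m 2 (2 * n))) (m≤n+m _ (F n 0 + F n 1))
  some-summand (suc m) le with suc m ≤? 2 * n + 1
  ... | yes m<2n+1 =
    <-≤-trans (F-pos n (2 + m) (s≤s (s≤s z≤n)) (subst (2 + m ≤_) (sym 2n+2≡) (s≤s m<2n+1)))
              (≤-trans (m≤n+m _ (F n (1 + m))) (m≤m+n _ (F n (3 + m))))
  ... | no m≮2n+1 =
    <-≤-trans (F-pos n (1 + m)
                (≤-trans (m≤n+m 2 (2 * n)) (subst (_≤ suc m) (sym 2n+2≡) (≰⇒> m≮2n+1))) le)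
              (≤-trans (m≤m+n _ _) (m≤m+n _ _))

-- Log-concavity

LogConcave : (ℕ → ℕ) → Set
LogConcave a = ∀ i → a i * a (2 + i) ≤ a (1 + i) * a (1 + i)

NoInternalZeros : (ℕ → ℕ) → Set
NoInternalZeros a = ∀ {i j k} → i ≤ j → j ≤ k → a j ≡ 0 → a i * a k ≡ 0

-- u/v ≤ x/y ≤ y/z, cross-multiplied
cross-≤-trans : ∀ {u v x y z} → u * y ≤ v * x → x * z ≤ y * y → 0 < x → 0 < y → u * z ≤ v * y
cross-≤-trans {u} {v} {x} {y} {z} uy≤vx xz≤yy 0<x 0<y =
  *-cancelʳ-≤ (u * z) (v * y) (x * y) {{>-nonZero (*-mono-< 0<x 0<y)}} (begin
    u * z * (x * y)     ≡⟨ solve (u ∷ v ∷ x ∷ y ∷ z ∷ []) ⟩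
    (u * y) * (x * z)   ≤⟨ *-mono-≤ uy≤vx xz≤yy ⟩
    (v * x) * (y * y)   ≡⟨ solve (u ∷ v ∷ x ∷ y ∷ z ∷ []) ⟩
    v * y * (x * y)     ∎)
  where open ≤-Reasoning

≡0⇒≤ : ∀ {x y} → x ≡ 0 → x ≤ y
≡0⇒≤ refl = z≤n

logConcave⇒ratio-antitone : ∀ {a} → LogConcave a → NoInternalZeros a →
  ∀ d i → a i * a (suc (d + i)) ≤ a (suc i) * a (d + i)
logConcave⇒ratio-antitone {a} lc niz zero i = ≤-reflexive (*-comm (a i) (a (suc i)))
logConcave⇒ratio-antitone {a} lc niz (suc d) i with a (d + i) ≟ 0 | a (suc d + i) ≟ 0
... | yes a≡0 | _ = ≡0⇒≤ (niz (m≤n+m i d) (m≤n⇒m≤1+n (m≤n⇒m≤1+n ≤-refl)) a≡0)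
... | no _ | yes a≡0 = ≡0⇒≤ (niz (m≤n+m i (suc d)) (m≤n⇒m≤1+n ≤-refl) a≡0)
... | no a≢0 | no a'≢0 =
  cross-≤-trans {a i} {a (suc i)} (logConcave⇒ratio-antitone lc niz d i) (lc (d + i))
    (n≢0⇒n>0 a≢0) (n≢0⇒n>0 a'≢0)

window-square : ∀ {x p q r y} → x * q ≤ p * p → q * y ≤ r * r → x * r ≤ p * q → p * y ≤ q * r →
  x * y ≤ p * r → (x + p + q) * (q + r + y) ≤ (p + q + r) * (p + q + r)
window-square {x} {p} {q} {r} {y} xq≤pp qy≤rr xr≤pq py≤qr xy≤pr = begin
  (x + p + q) * (q + r + y)                                        ≡⟨ solve (x ∷ p ∷ q ∷ r ∷ y ∷ []) ⟩
  x * q + q * y + x * r + p * y + x * y + (p * q + p * r + q * q + q * r)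
    ≤⟨ +-monoˡ-≤ (p * q + p * r + q * q + q * r)
         (+-mono-≤ (+-mono-≤ (+-mono-≤ (+-mono-≤ xq≤pp qy≤rr) xr≤pq) py≤qr) xy≤pr) ⟩
  p * p + r * r + p * q + q * r + p * r + (p * q + p * r + q * q + q * r)
                                                                   ≡⟨ solve (x ∷ p ∷ q ∷ r ∷ y ∷ []) ⟩
  (p + q + r) * (p + q + r)                                        ∎
  where open ≤-Reasoning

logConcave-window : ∀ {a} → LogConcave a → NoInternalZeros a → LogConcave (λ i → a i + a (1 + i) + a (2 + i))
logConcave-window {a} lc niz i =
  window-square {a i} {a (1 + i)} {a (2 + i)} {a (3 + i)} {a (4 + i)}
    (lc i) (lc (2 + i)) (cross 2 i) (cross 2 (1 + i)) (cross 3 i)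
  where cross = logConcave⇒ratio-antitone lc niz

F-noInternalZeros : ∀ n → NoInternalZeros (F n)
F-noInternalZeros n {zero} _ _ _ = refl
F-noInternalZeros n {suc zero} _ _ _ = refl
F-noInternalZeros n {suc (suc i)} {j} {k} i≤j j≤k Fj≡0 =
  trans (cong (F n (2 + i) *_) (F-vanishes n k (≤-trans beyond-support j≤k))) (*-zeroʳ (F n (2 + i)))
  where
  beyond-support : 2 * n + 3 ≤ j
  beyond-support with j ≤? 2 * n + 2
  ... | yes j≤ = contradiction Fj≡0 (>⇒≢ (F-pos n j (≤-trans (s≤s (s≤s z≤n)) i≤j) j≤))
  ... | no j≰ = subst (_≤ j) (sym (+-suc (2 * n) 2)) (≰⇒> j≰)

F-logConcave : ∀ n → LogConcave (F n)
F-logConcave n zero = z≤n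
F-logConcave n (suc zero) = z≤n
F-logConcave zero (suc (suc i)) = ≡0⇒≤ (*-zeroʳ (F 0 (2 + i)))
F-logConcave (suc n) (suc (suc m)) =
  subst₂ _≤_ (sym (cong₂ _*_ (F-suc n m) (F-suc n (2 + m))))
             (sym (cong₂ _*_ (F-suc n (1 + m)) (F-suc n (1 + m))))
    (logConcave-window (F-logConcave n) (F-noInternalZeros n) m)

diffRec-quadratic : ∀ i e {a b d} → DiffRec (suc (i + e)) (suc i) a b d → a * d ≤ b * b →
  e * a * b + (2 + i + 2 * e) * a * a ≤ (2 + i) * b * b
diffRec-quadratic i e {a} {b} {d} rec ad≤bb = begin
  e * a * b + (2 + i + 2 * e) * a * a  ≡⟨ +-cancelʳ-≡ _ _ _ scaled-rec ⟨
  (2 + i) * (a * d)                    ≤⟨ *-monoʳ-≤ (2 + i) ad≤bb ⟩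
  (2 + i) * (b * b)                    ≡⟨ *-assoc (2 + i) b b ⟨
  (2 + i) * b * b                      ∎
  where
  open ≤-Reasoning
  scaled-rec : (2 + i) * (a * d) + ((1 + i) * a * b + (1 + i) * a * a)
             ≡ e * a * b + (2 + i + 2 * e) * a * a + ((1 + i) * a * b + (1 + i) * a * a)
  scaled-rec = begin-equality
    (2 + i) * (a * d) + ((1 + i) * a * b + (1 + i) * a * a)   ≡⟨ solve (i ∷ a ∷ b ∷ d ∷ []) ⟩
    a * ((2 + i) * d + (1 + i) * b + (1 + i) * a)             ≡⟨ cong (a *_) rec ⟩
    a * (suc (i + e) * b + 2 * suc (i + e) * a + a)           ≡⟨ solve (i ∷ e ∷ a ∷ b ∷ []) ⟩
    e * a * b + (2 + i + 2 * e) * a * a + ((1 + i) * a * b + (1 + i) * a * a) ∎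

square-cancel-≤ : ∀ {a b} → a * a ≤ b * b → a ≤ b
square-cancel-≤ {a} {b} aa≤bb with a ≤? b
... | yes a≤b = a≤b
... | no a≰b = contradiction aa≤bb (<⇒≱ (*-mono-< (≰⇒> a≰b) (≰⇒> a≰b)))

quadratic⇒≤ : ∀ i e {a b} → e * a * b + (2 + i + 2 * e) * a * a ≤ (2 + i) * b * b → a ≤ b
quadratic⇒≤ i e {a} {b} q = square-cancel-≤ (*-cancelˡ-≤ (2 + i) (begin
  (2 + i) * (a * a)                      ≡⟨ *-assoc (2 + i) a a ⟨
  (2 + i) * a * a                        ≤⟨ *-monoˡ-≤ a (*-monoˡ-≤ a (m≤m+n (2 + i) (2 * e))) ⟩
  (2 + i + 2 * e) * a * a                ≤⟨ m≤n+m _ (e * a * b) ⟩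
  e * a * b + (2 + i + 2 * e) * a * a    ≤⟨ q ⟩
  (2 + i) * b * b                        ≡⟨ *-assoc (2 + i) b b ⟩
  (2 + i) * (b * b)                      ∎))
  where open ≤-Reasoning

-- If 5a > 3b then 5a ≥ 3b + 1, and 25 times the quadratic bound contradicts 16i + 32 ≤ 33e.
quadratic⇒ratio : ∀ i e {a b} → e * a * b + (2 + i + 2 * e) * a * a ≤ (2 + i) * b * b →
  16 * i + 32 ≤ 33 * e → 5 * a ≤ 3 * b
quadratic⇒ratio i e {a} {b} q slack with 5 * a ≤? 3 * b
... | yes 5a≤3b = 5a≤3b
... | no 5a≰3b = contradiction circular (<-irrefl refl)
  where
  open ≤-Reasoning
  3b<5a : 3 * b < 5 * a
  3b<5a = ≰⇒> 5a≰3b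
  circular : 25 * ((2 + i) * b * b) < 25 * ((2 + i) * b * b)
  circular = begin-strict
    25 * ((2 + i) * b * b)                                     ≡⟨ solve (i ∷ b ∷ []) ⟩
    (16 * i + 32 + (9 * i + 18)) * (b * b)                     <⟨ m<m+n _ z<s ⟩
    (16 * i + 32 + (9 * i + 18)) * (b * b) + (2 + i + 2 * e)
      ≤⟨ +-monoˡ-≤ (2 + i + 2 * e) (*-monoˡ-≤ (b * b) (+-monoˡ-≤ (9 * i + 18) slack)) ⟩
    (33 * e + (9 * i + 18)) * (b * b) + (2 + i + 2 * e)        ≤⟨ m≤m+n _ ((2 + i + 2 * e) * (6 * b)) ⟩
    (33 * e + (9 * i + 18)) * (b * b) + (2 + i + 2 * e) + (2 + i + 2 * e) * (6 * b)
                                                               ≡⟨ solve (i ∷ e ∷ b ∷ []) ⟩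
    5 * e * b * (3 * b) + (2 + i + 2 * e) * (suc (3 * b) * suc (3 * b))
      ≤⟨ +-mono-≤ (*-monoʳ-≤ (5 * e * b) (<⇒≤ 3b<5a))
                  (*-monoʳ-≤ (2 + i + 2 * e) (*-mono-≤ 3b<5a 3b<5a)) ⟩
    5 * e * b * (5 * a) + (2 + i + 2 * e) * (5 * a * (5 * a))  ≡⟨ solve (i ∷ e ∷ a ∷ b ∷ []) ⟩
    25 * (e * a * b + (2 + i + 2 * e) * a * a)                 ≤⟨ *-monoʳ-≤ 25 q ⟩
    25 * ((2 + i) * b * b)                                     ∎

f-quadratic : ∀ i e → let g = f (suc (i + e)) in
  e * g i * g (1 + i) + (2 + i + 2 * e) * g i * g i ≤ (2 + i) * g (1 + i) * g (1 + i)
f-quadratic i e = diffRec-quadratic i e (DiffRec-F (suc (i + e)) (suc i)) (F-logConcave (suc (i + e)) (2 + i))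

f-mono : ∀ n i → suc i ≤ n → f n i ≤ f n (suc i)
f-mono n i le with m≤n⇒∃[o]m+o≡n le
... | e , refl = quadratic⇒≤ i e (f-quadratic i e)

f-ratio : ∀ n i → 49 * i + 65 ≤ 33 * n → 5 * f n i ≤ 3 * f n (suc i)
f-ratio n i le = from-excess (m≤n⇒∃[o]m+o≡n i<n) le
  where
  open ≤-Reasoning
  i<n : suc i ≤ n
  i<n = *-cancelˡ-≤ 33 (begin
    33 * suc i                  ≤⟨ m≤m+n _ (16 * i + 32) ⟩
    33 * suc i + (16 * i + 32)  ≡⟨ solve (i ∷ []) ⟩
    49 * i + 65                 ≤⟨ le ⟩
    33 * n                      ∎)
  from-excess : ∀ {n} → ∃ (λ e → suc i + e ≡ n) → 49 * i + 65 ≤ 33 * n →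
    5 * f n i ≤ 3 * f n (suc i)
  from-excess (e , refl) bound = quadratic⇒ratio i e (f-quadratic i e) (+-cancelˡ-≤ (33 * suc i) _ _ (begin
    33 * suc i + (16 * i + 32)  ≡⟨ solve (i ∷ []) ⟩
    49 * i + 65                 ≤⟨ bound ⟩
    33 * suc (i + e)            ≡⟨ solve (i ∷ e ∷ []) ⟩
    33 * suc i + 33 * e         ∎))

-- Sequences growing geometrically

sumℕ : ℕ → ℕ → (ℕ → ℕ) → ℕ
sumℕ c zero a = 0
sumℕ c (suc L) a = a c + sumℕ (suc c) L a

stepwise-mono : ∀ {T} {a : ℕ → ℕ} → (∀ i → suc i ≤ T → a i ≤ a (suc i)) →
  ∀ {i j} → i ≤ j → j ≤ T → a i ≤ a j
stepwise-mono step {j = zero} z≤n _ = ≤-refl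
stepwise-mono {a = a} step {j = suc j} i≤1+j 1+j≤T with m≤n⇒m<n∨m≡n i≤1+j
... | inj₁ i<1+j =
  ≤-trans (stepwise-mono {a = a} step (s≤s⁻¹ i<1+j) (≤-trans (n≤1+n j) 1+j≤T)) (step j 1+j≤T)
... | inj₂ refl = ≤-refl

GrowsBelow : ℕ → (ℕ → ℕ) → Set
GrowsBelow T a = ∀ i → suc i ≤ T → 5 * a i ≤ 3 * a (suc i)

growth⇒≤ : ∀ {x y} → 5 * x ≤ 3 * y → x ≤ y
growth⇒≤ {x} {y} 5x≤3y = *-cancelˡ-≤ 3 (≤-trans (*-monoˡ-≤ x (m≤m+n 3 2)) 5x≤3y)

growth-pow : ∀ {T} {a : ℕ → ℕ} → GrowsBelow T a →
  ∀ d i → d + i ≤ T → 5 ^ d * a i ≤ 3 ^ d * a (d + i)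
growth-pow grows zero i _ = ≤-refl
growth-pow {T} {a} grows (suc d) i le = begin
  5 * 5 ^ d * a i              ≡⟨ *-assoc 5 (5 ^ d) (a i) ⟩
  5 * (5 ^ d * a i)            ≡⟨ x∙yz≈y∙xz 5 (5 ^ d) (a i) ⟩
  5 ^ d * (5 * a i)            ≤⟨ *-monoʳ-≤ (5 ^ d) (grows i (≤-trans (s≤s (m≤n+m i d)) le)) ⟩
  5 ^ d * (3 * a (suc i))      ≡⟨ x∙yz≈y∙xz (5 ^ d) 3 (a (suc i)) ⟩
  3 * (5 ^ d * a (suc i))
    ≤⟨ *-monoʳ-≤ 3 (growth-pow {a = a} grows d (suc i) (subst (_≤ T) (sym (+-suc d i)) le)) ⟩
  3 * (3 ^ d * a (d + suc i))  ≡⟨ cong (λ m → 3 * (3 ^ d * a m)) (+-suc d i) ⟩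
  3 * (3 ^ d * a (suc d + i))  ≡⟨ *-assoc 3 (3 ^ d) (a (suc d + i)) ⟨
  3 * 3 ^ d * a (suc d + i)    ∎
  where open ≤-Reasoning

geometric-sum : ∀ {T} {a : ℕ → ℕ} → GrowsBelow T a → ∀ c L → c + L ≤ T →
  2 * sumℕ c (suc L) a + 3 * a c ≤ 5 * a (c + L)
geometric-sum {a = a} grows c zero _ = ≤-reflexive (begin-equality
  2 * (a c + 0) + 3 * a c  ≡⟨ collect (a c) ⟩
  5 * a c                  ≡⟨ cong (λ m → 5 * a m) (+-identityʳ c) ⟨
  5 * a (c + 0)            ∎)
  where
  open ≤-Reasoning
  collect : ∀ x → 2 * (x + 0) + 3 * x ≡ 5 * x
  collect = solve-∀
geometric-sum {T} {a} grows c (suc L) le = begin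
  2 * (a c + S) + 3 * a c       ≡⟨ collect (a c) S ⟩
  2 * S + 5 * a c               ≤⟨ +-monoʳ-≤ (2 * S) (grows c (≤-trans (s≤s (m≤m+n c L)) le′)) ⟩
  2 * S + 3 * a (suc c)         ≤⟨ geometric-sum {a = a} grows (suc c) L le′ ⟩
  5 * a (suc c + L)             ≡⟨ cong (λ m → 5 * a m) (+-suc c L) ⟨
  5 * a (c + suc L)             ∎
  where
  open ≤-Reasoning
  S = sumℕ (suc c) (suc L) a
  le′ : suc c + L ≤ T
  le′ = subst (_≤ T) (+-suc c L) le
  collect : ∀ x s → 2 * (x + s) + 3 * x ≡ 2 * s + 5 * x
  collect = solve-∀

weightedSum : (ℕ → ℕ) → ℕ → ℕ → ℕ
weightedSum a c L = a c + 2 * a (suc c) + sumℕ (suc (suc c)) L a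

weightedSum<-3-beyond : ∀ {T} {a : ℕ → ℕ} {j} → GrowsBelow T a → ∀ c L →
  3 + (c + suc L) ≤ T → a (3 + (c + suc L)) ≤ a j → 0 < a j → weightedSum a c L < a j
weightedSum<-3-beyond {T} {a} {j} grows c L in-range far 0<aj = *-cancelˡ-< 250 _ _ (begin-strict
  250 * weightedSum a c L                ≡⟨ *-assoc 125 2 (weightedSum a c L) ⟩
  125 * (2 * weightedSum a c L)          ≤⟨ *-monoʳ-≤ 125 twice-bound ⟩
  125 * (7 * a M)                        ≡⟨ x∙yz≈y∙xz 125 7 (a M) ⟩
  7 * (125 * a M)                        ≤⟨ *-monoʳ-≤ 7 (growth-pow {a = a} grows 3 M in-range) ⟩
  7 * (27 * a (3 + M))                   ≤⟨ *-monoʳ-≤ 7 (*-monoʳ-≤ 27 far) ⟩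
  7 * (27 * a j)                         ≡⟨ *-assoc 7 27 (a j) ⟨
  189 * a j                              <⟨ *-monoˡ-< (a j) {{>-nonZero 0<aj}} (m<m+n 189 {61} z<s) ⟩
  250 * a j                              ∎)
  where
  open ≤-Reasoning
  M = c + suc L
  S = sumℕ (suc (suc c)) L a
  M≤T : M ≤ T
  M≤T = ≤-trans (m≤n+m M 3) in-range
  middle≤top : a (suc c) ≤ a M
  middle≤top = stepwise-mono {a = a} (λ i i<T → growth⇒≤ (grows i i<T))
    (subst (suc c ≤_) (sym (+-suc c L)) (s≤s (m≤m+n c L))) M≤T
  regroup : ∀ x y s → 2 * (x + 2 * y + s) ≡ 2 * (x + (y + s)) + 2 * y
  regroup = solve-∀
  twice-bound : 2 * weightedSum a c L ≤ 7 * a M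
  twice-bound = begin
    2 * weightedSum a c L                                   ≡⟨ regroup (a c) (a (suc c)) S ⟩
    2 * sumℕ c (suc (suc L)) a + 2 * a (suc c)
      ≤⟨ +-monoˡ-≤ (2 * a (suc c)) (m≤m+n (2 * sumℕ c (suc (suc L)) a) (3 * a c)) ⟩
    2 * sumℕ c (suc (suc L)) a + 3 * a c + 2 * a (suc c)
      ≤⟨ +-mono-≤ (geometric-sum {a = a} grows c (suc L) M≤T)
                  (*-monoʳ-≤ 2 middle≤top) ⟩
    5 * a M + 2 * a M                                       ≡⟨ *-distribʳ-+ (a M) 5 2 ⟨
    7 * a M                                                 ∎

weightedSum₁<-2-beyond : ∀ {T} {a : ℕ → ℕ} → GrowsBelow T a → ∀ c → 4 + c ≤ T → 0 < a (4 + c) →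
  weightedSum a c 1 < a (4 + c)
weightedSum₁<-2-beyond {a = a} grows c in-range 0<a = *-cancelˡ-< 625 _ _ (begin-strict
  625 * weightedSum a c 1                                                ≡⟨ expand (a c) (a (1 + c)) (a (2 + c)) ⟩
  5 ^ 4 * a c + 10 * (5 ^ 3 * a (1 + c)) + 25 * (5 ^ 2 * a (2 + c))
    ≤⟨ +-mono-≤ (+-mono-≤ (growth-pow {a = a} grows 4 c in-range)
                          (*-monoʳ-≤ 10 (growth-pow {a = a} grows 3 (1 + c) in-range)))
                (*-monoʳ-≤ 25 (growth-pow {a = a} grows 2 (2 + c) in-range)) ⟩
  3 ^ 4 * a (4 + c) + 10 * (3 ^ 3 * a (4 + c)) + 25 * (3 ^ 2 * a (4 + c))  ≡⟨ collect (a (4 + c)) ⟩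
  576 * a (4 + c)
    <⟨ *-monoˡ-< (a (4 + c)) {{>-nonZero 0<a}} (m<m+n 576 {49} z<s) ⟩
  625 * a (4 + c)                                                         ∎)
  where
  open ≤-Reasoning
  expand : ∀ x y z → 625 * (x + 2 * y + (z + 0)) ≡ 625 * x + 10 * (125 * y) + 25 * (25 * z)
  expand = solve-∀
  collect : ∀ x → 81 * x + 10 * (27 * x) + 25 * (9 * x) ≡ 576 * x
  collect = solve-∀

-- The case n = 3s

half-bounds : ∀ m → m / 2 * 2 ≤ m × m ≤ suc (m / 2 * 2)
half-bounds m = m/n*n≤m m 2 ,
  subst (_≤ suc (m / 2 * 2)) (sym (m≡m%n+[m/n]*n m 2)) (+-monoˡ-≤ (m / 2 * 2) (s≤s⁻¹ (m%n<n m 2)))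

floor-near : ∀ k → (3 * suc k + k) / 2 ≡ suc (2 * k)
floor-near k = begin
  (3 * suc k + k) / 2            ≡⟨ cong (_/ 2) (odd k) ⟩
  (1 + suc (2 * k) * 2) / 2      ≡⟨ +-distrib-/-∣ʳ 1 {d = 2} (divides (suc (2 * k)) refl) ⟩
  suc (2 * k) * 2 / 2            ≡⟨ m*n/n≡m (suc (2 * k)) 2 ⟩
  suc (2 * k)                    ∎
  where
  open ≡-Reasoning
  odd : ∀ k → 3 * suc k + k ≡ 1 + suc (2 * k) * 2
  odd = solve-∀

floor-bounds-far : ∀ k t M → M * 2 ≤ 3 * (2 + k + t) + k → 3 * (2 + k + t) + k ≤ suc (M * 2) →
  2 * k ≤ M × suc M ≤ 2 * (2 + k + t) × 3 + M + k ≤ 3 * (2 + k + t)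
floor-bounds-far k t M upper lower = lo , mid , hi
  where
  open ≤-Reasoning
  lo : 2 * k ≤ M
  lo = *-cancelˡ-≤ 2 (s≤s⁻¹ (begin
    suc (2 * (2 * k))                ≤⟨ m≤m+n _ (5 + 3 * t) ⟩
    suc (2 * (2 * k)) + (5 + 3 * t)  ≡⟨ solve (k ∷ t ∷ []) ⟩
    3 * (2 + k + t) + k              ≤⟨ lower ⟩
    suc (M * 2)                      ≡⟨ cong suc (*-comm M 2) ⟩
    suc (2 * M)                      ∎))
  mid : suc M ≤ 2 * (2 + k + t)
  mid = *-cancelˡ-≤ 2 (begin
    2 * suc M                            ≡⟨ solve (M ∷ []) ⟩
    2 + M * 2                            ≤⟨ +-monoʳ-≤ 2 upper ⟩
    2 + (3 * (2 + k + t) + k)            ≤⟨ m≤m+n _ t ⟩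
    2 + (3 * (2 + k + t) + k) + t        ≡⟨ solve (k ∷ t ∷ []) ⟩
    2 * (2 * (2 + k + t))                ∎)
  hi : 3 + M + k ≤ 3 * (2 + k + t)
  hi = *-cancelˡ-≤ 2 (begin
    2 * (3 + M + k)                            ≡⟨ solve (k ∷ M ∷ []) ⟩
    6 + 2 * k + M * 2                          ≤⟨ +-monoʳ-≤ (6 + 2 * k) upper ⟩
    6 + 2 * k + (3 * (2 + k + t) + k)          ≤⟨ m≤m+n _ (3 * t) ⟩
    6 + 2 * k + (3 * (2 + k + t) + k) + 3 * t  ≡⟨ solve (k ∷ t ∷ []) ⟩
    2 * (3 * (2 + k + t))                      ∎)

f-pos : ∀ n j → j ≤ n → 0 < f n j
f-pos n j j≤n = F-pos n (2 + j) (s≤s (s≤s z≤n))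
  (subst (2 + j ≤_) (+-comm 2 (2 * n)) (s≤s (s≤s (≤-trans j≤n (m≤m+n n (n + 0))))))

-- At i = 2s + 1 the condition 49i + 65 ≤ 33 · 3s reads s ≥ 114.
f-grows : ∀ s → 114 ≤ s → GrowsBelow (2 + 2 * s) (f (3 * s))
f-grows s s≥114 i i<T = f-ratio (3 * s) i (begin
  49 * i + 65             ≤⟨ +-monoˡ-≤ 65 (*-monoʳ-≤ 49 (s≤s⁻¹ i<T)) ⟩
  49 * (1 + 2 * s) + 65   ≡⟨ solve (s ∷ []) ⟩
  98 * s + 114            ≤⟨ +-monoʳ-≤ (98 * s) s≥114 ⟩
  98 * s + s              ≡⟨ solve (s ∷ []) ⟩
  33 * (3 * s)            ∎)
  where open ≤-Reasoning

Dominated : ℕ → ℕ → Set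
Dominated s k = weightedSum (f (3 * s)) (2 * k ∸ 1) ((3 * s + k) / 2 ∸ 2 * k) < f (3 * s) (3 * s ∸ k)

dominated-near : ∀ k → 114 ≤ 2 + k → Dominated (2 + k) (suc k)
dominated-near k s≥114 = subst₂ (λ L j → weightedSum a c L < a j) (sym L≡1) (sym j≡4+c)
  (weightedSum₁<-2-beyond {a = a} (f-grows s s≥114) c in-range (subst (λ j → 0 < a j) j≡4+c 0<aj))
  where
  s = 2 + k
  K = suc k
  a = f (3 * s)
  c = 2 * K ∸ 1
  L≡1 : (3 * s + K) / 2 ∸ 2 * K ≡ 1
  L≡1 = trans (cong (_∸ 2 * K) (floor-near K))
              (trans (+-∸-assoc 1 (≤-refl {2 * K})) (cong suc (n∸n≡0 (2 * K))))
  triple : ∀ k → 3 * (2 + k) ≡ 3 + 2 * suc k + suc k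
  triple = solve-∀
  j≡4+c : 3 * s ∸ K ≡ 4 + c
  j≡4+c = trans (cong (_∸ K) (triple k)) (m+n∸n≡m (4 + c) K)
  in-range : 4 + c ≤ 2 + 2 * s
  in-range = subst (λ m → 3 + 2 * K ≤ 2 + m) (sym (*-suc 2 K)) (n≤1+n _)
  0<aj : 0 < a (3 * s ∸ K)
  0<aj = f-pos (3 * s) (3 * s ∸ K) (m∸n≤m _ K)

dominated-far : ∀ k t → 114 ≤ 2 + suc k + t → Dominated (2 + suc k + t) (suc k)
dominated-far k t s≥114 = weightedSum<-3-beyond {a = a} (f-grows s s≥114) c L
  (subst (λ m → 3 + m ≤ 2 + 2 * s) (sym top≡M) (s≤s (s≤s mid)))
  (subst (λ m → a (3 + m) ≤ a (3 * s ∸ K)) (sym top≡M)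
    (stepwise-mono {a = a} (f-mono (3 * s)) (m+n≤o⇒m≤o∸n (3 + M) hi) (m∸n≤m _ K)))
  (f-pos (3 * s) (3 * s ∸ K) (m∸n≤m _ K))
  where
  K = suc k
  s = 2 + K + t
  a = f (3 * s)
  c = 2 * K ∸ 1
  M = (3 * s + K) / 2
  L = M ∸ 2 * K
  bounds = floor-bounds-far K t M (proj₁ (half-bounds (3 * s + K))) (proj₂ (half-bounds (3 * s + K)))
  lo = proj₁ bounds
  mid = proj₁ (proj₂ bounds)
  hi = proj₂ (proj₂ bounds)
  top≡M : c + suc L ≡ M
  top≡M = trans (+-suc c L) (m+[n∸m]≡n lo)

f-dominated : ∀ s → 114 ≤ s → ∀ k → 0 < k → k < s → Dominated s k
f-dominated s s≥114 (suc k) _ k<s with m≤n⇒m<n∨m≡n k<s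
... | inj₂ refl = dominated-near k s≥114
... | inj₁ k+1<s with m≤n⇒∃[o]m+o≡n k+1<s
...   | t , refl = dominated-far k t s≥114

sumFrom-+ : ∀ c L (a : ℕ → ℕ) → sumFrom c L (λ i → + a i) ≡ + sumℕ c L a
sumFrom-+ c zero a = refl
sumFrom-+ c (suc L) a = trans (cong (ℤ._+_ (+ a c)) (sumFrom-+ (suc c) L a)) (sym (ℤP.pos-+ (a c) _))

m<n⇒m-n<0 : ∀ {m n} → m < n → + m ℤ.- + n ℤ.< + 0
m<n⇒m-n<0 {m} {n} m<n =
  subst (+ m ℤ.- + n ℤ.<_) (ℤP.+-inverseʳ (+ n)) (ℤP.+-monoˡ-< (ℤ.- + n) (ℤ.+<+ m<n))

weightedSum-ℤ : ∀ (a : ℕ → ℕ) c L →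
  (+ a c ℤ.+ (+ 2) ℤ.* (+ a (suc c))) ℤ.+ sumFrom (suc (suc c)) L (λ i → + a i) ≡ + weightedSum a c L
weightedSum-ℤ a c L = begin
  (+ a c ℤ.+ (+ 2) ℤ.* (+ a (suc c))) ℤ.+ sumFrom (suc (suc c)) L (λ i → + a i)
    ≡⟨ cong₂ ℤ._+_ (cong (ℤ._+_ (+ a c)) (ℤP.pos-* 2 (a (suc c)))) (sym (sumFrom-+ (suc (suc c)) L a)) ⟨
  (+ a c ℤ.+ + (2 * a (suc c))) ℤ.+ + sumℕ (suc (suc c)) L a
    ≡⟨ cong (ℤ._+ + sumℕ (suc (suc c)) L a) (ℤP.pos-+ (a c) (2 * a (suc c))) ⟨
  + (a c + 2 * a (suc c)) ℤ.+ + sumℕ (suc (suc c)) L a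
    ≡⟨ ℤP.pos-+ (a c + 2 * a (suc c)) (sumℕ (suc (suc c)) L a) ⟨
  + weightedSum a c L ∎
  where open ≡-Reasoning

lemma3p6 : ∃ λ (N : ℕ) → ∀ (s : ℕ) → N ≤ 3 * s → ∀ (k : ℕ) → 0 < k → k < s →
    (((+ f (3 * s) (2 * k ∸ 1) ℤ.+ (+ 2) ℤ.* (+ f (3 * s) (2 * k)))
      ℤ.+ sumFrom (suc (2 * k)) (suc ((3 * s + k) / 2) ∸ suc (2 * k)) (λ i → + f (3 * s) i))
      ℤ.- (+ f (3 * s) (3 * s ∸ k))) ℤ.< + 0
lemma3p6 = 342 , λ where
  s _ zero () _
  -- for k = suc _, suc (2 * k ∸ 1) reduces to 2 * k, so the left-hand side is weightedSum on the nose
  s 342≤3s (suc k) 0<k k<s →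
    subst (λ z → z ℤ.- + f (3 * s) (3 * s ∸ suc k) ℤ.< + 0)
      (sym (weightedSum-ℤ (f (3 * s)) (2 * suc k ∸ 1) ((3 * s + suc k) / 2 ∸ 2 * suc k)))
      (m<n⇒m-n<0 (f-dominated s (*-cancelˡ-≤ 3 342≤3s) (suc k) 0<k k<s))
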